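{- Let $s\ge 2$ and $t$ be integers, let $g=\frac{s-1}{\gcd(s-1,t)}$, and let $g=p_1^{j_1}\cdots p_n^{j_n}$ be its prime factorization (distinct primes $p_i$, $j_i\ge 1$). Let $r\ge 2$ be an integer with $\gcd(r,s)=1$, written as $r=p_1^{m_1}\cdots p_n^{m_n}k$ with integers $m_i\ge 0$ and $k$ a positive integer with $\gcd(k,g)=1$. If $\operatorname{ord}_{p_i^{m_i+j_i}}(s)$ divides $\operatorname{ord}_r(s)$ for every $i=1,\dots,n$, then $r$ is distinguished with respect to $(s,t)$. In particular, if $\operatorname{ord}_{p_i^{m_i+j_i}}(s)$ divides $\operatorname{ord}_k(s)$ for every $i=1,\dots,n$, then $r$ is distinguished with respect to $(s,t)$, and so is $k$ provided $k\ge 2$.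
   Context: For integers $s$ and $r\ge 1$ with $\gcd(r,s)=1$, $\operatorname{ord}_r(s)$ denotes the least positive integer $m$ with $s^m\equiv 1\pmod r$. For integers $s\ge 2$ and $t$, an integer $r\ge 2$ is distinguished with respect to $(s,t)$ if $\gcd(r,s)=1$ and $r$ divides $t\cdot\frac{s^{\operatorname{ord}_r(s)}-1}{s-1}$. Since each $p_i$ divides $s-1$, $\gcd(p_i,s)=1$. -}

module Defs where

open import Data.Nat using (ℕ; zero; suc; _+_; _*_; _∸_; _^_; _≤_; _/_)
open import Data.Nat.GCD using (gcd)
open import Data.Integer as ℤ using (ℤ; +_; _-_)
open import Data.Integer.Divisibility as ℤD using ()
open import Data.Fin using (Fin; zero; suc)
open import Data.Product using (Σ; _×_; _,_)
open import Relation.Binary.PropositionalEquality using (_≡_)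

PowCong1 : ℕ → ℕ → ℕ → Set
PowCong1 r s m = (+ r) ℤD.∣ (+ (s ^ m) - + 1)

IsOrd : ℕ → ℕ → ℕ → Set
IsOrd r s m = (1 ≤ m) × PowCong1 r s m × (∀ m′ → 1 ≤ m′ → PowCong1 r s m′ → m ≤ m′)

-- (s ^ m - 1) / (s - 1) for s ≥ 2 (exact division); junk value 0 for s < 2.
repQuot : ℕ → ℕ → ℕ
repQuot (suc (suc s′)) m = (suc (suc s′) ^ m ∸ 1) / suc s′
repQuot _ _ = 0

Distinguished : ℕ → ℤ → ℕ → Set
Distinguished s t r =
  (2 ≤ r) × (gcd r s ≡ 1) ×
  Σ ℕ (λ o → IsOrd r s o × ((+ r) ℤD.∣ (t ℤ.* + (repQuot s o))))

∏ : (n : ℕ) → (Fin n → ℕ) → ℕ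
∏ zero f = 1
∏ (suc n) f = f zero * ∏ n (λ i → f (suc i))

-- Let o = ord_r(s) and X = s^o - 1.  Each p_i^(m_i+j_i) divides X because its order divides o,
-- and k ∣ r ∣ X; these factors are pairwise coprime, so r * g = ∏ p_i^(m_i+j_i) * k divides
-- X = (s - 1) * Q with Q = X / (s - 1).  As s - 1 = g * gcd(s - 1, t), cancelling g leaves
-- r ∣ gcd(s - 1, t) * Q ∣ t * Q.  For the second part, k ∣ r gives ord_k(s) ∣ ord_r(s), and the
-- same argument with o = ord_k(s) gives k * g ∣ r * g ∣ s^o - 1.
module Submission where

open import Data.Nat
open import Data.Nat.Properties
open import Data.Nat.Divisibility
open import Data.Nat.DivMod using (m%n<n; m≡m%n+[m/n]*n; m/n*n≡m)
open import Data.Nat.Coprimality as Coprime using (Coprime; coprime-divisor; gcd≡1⇒coprime; coprime⇒gcd≡1)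
open import Data.Nat.GCD using (gcd; gcd[m,n]∣n; gcd-greatest)
open import Data.Nat.Primality using (Prime; prime⇒irreducible; prime⇒nonTrivial; prime⇒nonZero)
open import Data.Nat.Induction using (<-wellFounded)
open import Data.Nat.Tactic.RingSolver using (solve-∀)
open import Data.Fin using (Fin; zero; suc; toℕ; fromℕ<)
open import Data.Fin.Properties as Fin using (pigeonhole; toℕ-fromℕ<)
open import Data.Integer as ℤ using (ℤ; +_; ∣_∣)
import Data.Integer.Properties as ℤ
open import Data.Product using (∃; _×_; _,_; proj₂)
open import Data.Sum using (inj₁; inj₂)
open import Function using (_∘_)
open import Function.Definitions using (Injective)
open import Induction.WellFounded using (Acc; acc)
open import Relation.Nullary using (¬_; yes; no; contradiction)
open import Relation.Nullary.Decidable using (_×-dec_)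
open import Relation.Unary using (Pred; Decidable)
open import Relation.Binary.PropositionalEquality
open import Defs

private
  variable
    a b d e k M N o x : ℕ

*-∸1 : 1 ≤ a → 1 ≤ b → a * b ∸ 1 ≡ a * (b ∸ 1) + (a ∸ 1)
*-∸1 {suc a} {suc b} _ _ = identity a b
  where
  identity : ∀ a b → b + a * suc b ≡ suc a * b + a
  identity = solve-∀

m∸1∣m^n∸1 : ∀ m n → m ∸ 1 ∣ m ^ n ∸ 1
m∸1∣m^n∸1 zero    zero    = ∣-refl
m∸1∣m^n∸1 zero    (suc n) = ∣-refl
m∸1∣m^n∸1 (suc m) zero    = m ∣0
m∸1∣m^n∸1 (suc m) (suc n) =
  subst (m ∣_) (sym (*-∸1 (s≤s z≤n) (m^n>0 (suc m) n)))
    (∣m∣n⇒∣m+n (∣n⇒∣m*n (suc m) (m∸1∣m^n∸1 (suc m) n)) ∣-refl)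

∣m^n∸1⇒∣m^[o*n]∸1 : ∀ m n o → d ∣ m ^ n ∸ 1 → d ∣ m ^ (o * n) ∸ 1
∣m^n∸1⇒∣m^[o*n]∸1 m n o d∣ =
  subst (λ y → _ ∣ y ∸ 1) (trans (^-*-assoc m n o) (cong (m ^_) (*-comm n o)))
    (∣-trans d∣ (m∸1∣m^n∸1 (m ^ n) o))

∣m^n∸1∧n∣o⇒∣m^o∸1 : ∀ m {n o} → d ∣ m ^ n ∸ 1 → n ∣ o → d ∣ m ^ o ∸ 1
∣m^n∸1∧n∣o⇒∣m^o∸1 m {n} d∣ (divides q refl) = ∣m^n∸1⇒∣m^[o*n]∸1 m n q d∣

1≤n⇒m∣m^n : ∀ m {n} → 1 ≤ n → m ∣ m ^ n
1≤n⇒m∣m^n m {suc n} _ = m∣m*n (m ^ n)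

m%d≡n%d⇒d∣n∸m : ∀ m n d .{{_ : NonZero d}} → m % d ≡ n % d → d ∣ n ∸ m
m%d≡n%d⇒d∣n∸m m n d eq = divides (n / d ∸ m / d) (begin
  n ∸ m                                      ≡⟨ cong₂ _∸_ (m≡m%n+[m/n]*n n d) (m≡m%n+[m/n]*n m d) ⟩
  (n % d + n / d * d) ∸ (m % d + m / d * d)  ≡⟨ cong (λ y → (n % d + n / d * d) ∸ (y + m / d * d)) eq ⟩
  (n % d + n / d * d) ∸ (n % d + m / d * d)  ≡⟨ [m+n]∸[m+o]≡n∸o (n % d) _ _ ⟩
  n / d * d ∸ m / d * d                      ≡⟨ *-distribʳ-∸ d (n / d) (m / d) ⟨
  (n / d ∸ m / d) * d                        ∎)
  where open ≡-Reasoning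

module _ {ℓ} {P : Pred ℕ ℓ} (P? : Decidable P) where

  least-witness : P k → ∃ λ m → P m × (∀ n → P n → m ≤ n)
  least-witness {k} = search k (<-wellFounded k)
    where
    search : ∀ n → Acc _<_ n → P n → ∃ λ m → P m × (∀ n → P n → m ≤ n)
    search n (acc below) Pn with anyUpTo? P? n
    ... | yes (m , m<n , Pm) = search m (below m<n) Pm
    ... | no ∄m<n            = n , Pn , λ m Pm → ≮⇒≥ (λ m<n → ∄m<n (m , m<n , Pm))

coprime-*ʳ : Coprime a b → Coprime a d → Coprime a (b * d)
coprime-*ʳ a⊥b a⊥d {c} (c∣a , c∣bd) = a⊥d (c∣a , coprime-divisor c⊥b c∣bd)
  where
  c⊥b : Coprime c _
  c⊥b (x∣c , x∣b) = a⊥b (∣-trans x∣c c∣a , x∣b)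

coprime-^ʳ : Coprime a b → ∀ e → Coprime a (b ^ e)
coprime-^ʳ a⊥b zero    (_ , c∣1) = ∣1⇒≡1 c∣1
coprime-^ʳ a⊥b (suc e) = coprime-*ʳ a⊥b (coprime-^ʳ a⊥b e)

coprime-^ˡ : Coprime a b → ∀ e → Coprime (a ^ e) b
coprime-^ˡ a⊥b e = Coprime.sym (coprime-^ʳ (Coprime.sym a⊥b) e)

coprime-*-∣ : Coprime a b → a ∣ x → b ∣ x → a * b ∣ x
coprime-*-∣ {a} {b} a⊥b (divides c refl) b∣ca =
  subst (a * b ∣_) (*-comm a c)
    (*-monoʳ-∣ a (coprime-divisor (Coprime.sym a⊥b) (subst (b ∣_) (*-comm c a) b∣ca)))

prime∤1 : ∀ {p} → Prime p → ¬ p ∣ 1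
prime∤1 p-prime p∣1 = nonTrivial⇒≢1 {{prime⇒nonTrivial p-prime}} (∣1⇒≡1 p∣1)

prime∣n⇒∤1+n : ∀ {p n} → Prime p → p ∣ n → ¬ p ∣ suc n
prime∣n⇒∤1+n {p} {n} p-prime p∣n p∣1+n =
  prime∤1 p-prime (∣m+n∣m⇒∣n (subst (p ∣_) (+-comm 1 n) p∣1+n) p∣n)

prime∤⇒coprime : ∀ {p n} → Prime p → ¬ p ∣ n → Coprime p n
prime∤⇒coprime p-prime p∤n (c∣p , c∣n) with prime⇒irreducible p-prime c∣p
... | inj₁ c≡1 = c≡1
... | inj₂ refl = contradiction c∣n p∤n

prime≢⇒coprime-^ : ∀ {p q} → Prime p → Prime q → p ≢ q → ∀ e f → Coprime (p ^ e) (q ^ f)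
prime≢⇒coprime-^ p-prime q-prime p≢q e f = coprime-^ʳ (coprime-^ˡ p⊥q e) f
  where
  p∤q : ¬ _ ∣ _
  p∤q p∣q with prime⇒irreducible q-prime p∣q
  ... | inj₁ p≡1 = nonTrivial⇒≢1 {{prime⇒nonTrivial p-prime}} p≡1
  ... | inj₂ p≡q = p≢q p≡q
  p⊥q = prime∤⇒coprime p-prime p∤q

∣∏ : ∀ n (f : Fin n → ℕ) i → f i ∣ ∏ n f
∣∏ (suc n) f zero    = m∣m*n (∏ n (f ∘ suc))
∣∏ (suc n) f (suc i) = ∣n⇒∣m*n (f zero) (∣∏ n (f ∘ suc) i)

∏-^-distribˡ-+ : ∀ n (p u v : Fin n → ℕ) →
                 ∏ n (λ i → p i ^ (u i + v i)) ≡ ∏ n (λ i → p i ^ u i) * ∏ n (λ i → p i ^ v i)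
∏-^-distribˡ-+ zero    p u v = refl
∏-^-distribˡ-+ (suc n) p u v = trans
  (cong₂ _*_ (^-distribˡ-+-* (p zero) (u zero) (v zero)) (∏-^-distribˡ-+ n (p ∘ suc) (u ∘ suc) (v ∘ suc)))
  ([m*n]*[o*p]≡[m*o]*[n*p] (p zero ^ u zero) (p zero ^ v zero) _ _)

∏-^-distribˡ-+-*ʳ : ∀ n (p u v : Fin n → ℕ) k →
                    ∏ n (λ i → p i ^ (u i + v i)) * k ≡ ∏ n (λ i → p i ^ u i) * k * ∏ n (λ i → p i ^ v i)
∏-^-distribˡ-+-*ʳ n p u v k = trans (cong (_* k) (∏-^-distribˡ-+ n p u v))
  (rearrange (∏ n (λ i → p i ^ u i)) (∏ n (λ i → p i ^ v i)) k)
  where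
  rearrange : ∀ x y z → x * y * z ≡ x * z * y
  rearrange = solve-∀

coprime-∏ʳ : ∀ n (f : Fin n → ℕ) → (∀ i → Coprime a (f i)) → Coprime a (∏ n f)
coprime-∏ʳ zero    f _       (_ , c∣1) = ∣1⇒≡1 c∣1
coprime-∏ʳ (suc n) f a⊥f = coprime-*ʳ (a⊥f zero) (coprime-∏ʳ n (f ∘ suc) (a⊥f ∘ suc))

pairwise-coprime⇒∏∣ : ∀ n (f : Fin n → ℕ) → (∀ i j → i ≢ j → Coprime (f i) (f j)) →
                      (∀ i → f i ∣ x) → ∏ n f ∣ x
pairwise-coprime⇒∏∣ zero    f _        _   = 1∣ _
pairwise-coprime⇒∏∣ (suc n) f pairwise f∣x = coprime-*-∣
  (coprime-∏ʳ n (f ∘ suc) (λ i → pairwise zero (suc i) λ ()))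
  (f∣x zero)
  (pairwise-coprime⇒∏∣ n (f ∘ suc) (λ i j i≢j → pairwise (suc i) (suc j) (i≢j ∘ Fin.suc-injective))
    (f∣x ∘ suc))

∏-prime-powers-*-∣ : ∀ n {p e : Fin n → ℕ} → (∀ i → Prime (p i)) → Injective _≡_ _≡_ p →
                     (∀ i → ¬ p i ∣ k) → (∀ i → p i ^ e i ∣ x) → k ∣ x →
                     ∏ n (λ i → p i ^ e i) * k ∣ x
∏-prime-powers-*-∣ n {p} {e} p-prime p-inj p∤k pᵉ∣x k∣x = coprime-*-∣
  (Coprime.sym (coprime-∏ʳ n _ λ i → Coprime.sym (coprime-^ˡ (prime∤⇒coprime (p-prime i) (p∤k i)) (e i))))
  (pairwise-coprime⇒∏∣ n _
    (λ i j i≢j → prime≢⇒coprime-^ (p-prime i) (p-prime j) (i≢j ∘ p-inj) (e i) (e j)) pᵉ∣x)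
  k∣x

∣1+m^n-1∣≡1+m^n∸1 : ∀ m n → ∣ + (suc m ^ n) ℤ.- + 1 ∣ ≡ suc m ^ n ∸ 1
∣1+m^n-1∣≡1+m^n∸1 m n = cong ∣_∣ (ℤ.⊖-≥ (m^n>0 (suc m) n))

PowCong1⇒∣ : ∀ a e → PowCong1 M (suc a) e → M ∣ suc a ^ e ∸ 1
PowCong1⇒∣ {M} a e = subst (M ∣_) (∣1+m^n-1∣≡1+m^n∸1 a e)

∣⇒PowCong1 : ∀ a e → M ∣ suc a ^ e ∸ 1 → PowCong1 M (suc a) e
∣⇒PowCong1 {M} a e = subst (M ∣_) (sym (∣1+m^n-1∣≡1+m^n∸1 a e))

IsOrd⇒∣pow∸1 : IsOrd M (suc a) o → o ∣ e → M ∣ suc a ^ e ∸ 1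
IsOrd⇒∣pow∸1 {a = a} {o} (_ , M∣ , _) = ∣m^n∸1∧n∣o⇒∣m^o∸1 (suc a) (PowCong1⇒∣ a o M∣)

-- By pigeonhole two of a^0, …, a^M agree mod M, and a^u cancels from a^u * (a^(v-u) - 1).
coprime⇒∃∣m^e∸1 : ∀ M .{{_ : NonZero M}} a → Coprime M a → ∃ λ e → 1 ≤ e × M ∣ a ^ e ∸ 1
coprime⇒∃∣m^e∸1 M a M⊥a with pigeonhole (n<1+n M) (λ i → fromℕ< (m%n<n (a ^ toℕ i) M))
... | i , j , i<j , same-residue =
  v ∸ u , m<n⇒0<n∸m i<j , coprime-divisor (coprime-^ʳ M⊥a u) (subst (M ∣_) aᵛ∸aᵘ≡ M∣aᵛ∸aᵘ)
  where
  u v : ℕ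
  u = toℕ i
  v = toℕ j
  M∣aᵛ∸aᵘ : M ∣ a ^ v ∸ a ^ u
  M∣aᵛ∸aᵘ = m%d≡n%d⇒d∣n∸m (a ^ u) (a ^ v) M (begin
    a ^ u % M                        ≡⟨ toℕ-fromℕ< (m%n<n (a ^ u) M) ⟨
    toℕ (fromℕ< (m%n<n (a ^ u) M))  ≡⟨ cong toℕ same-residue ⟩
    toℕ (fromℕ< (m%n<n (a ^ v) M))  ≡⟨ toℕ-fromℕ< (m%n<n (a ^ v) M) ⟩
    a ^ v % M                        ∎)
    where open ≡-Reasoning
  aᵛ∸aᵘ≡ : a ^ v ∸ a ^ u ≡ a ^ u * (a ^ (v ∸ u) ∸ 1)
  aᵛ∸aᵘ≡ = begin
    a ^ v ∸ a ^ u                    ≡⟨ cong (λ y → a ^ y ∸ a ^ u) (m+[n∸m]≡n (<⇒≤ i<j)) ⟨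
    a ^ (u + (v ∸ u)) ∸ a ^ u        ≡⟨ cong₂ _∸_ (^-distribˡ-+-* a u (v ∸ u)) (sym (*-identityʳ (a ^ u))) ⟩
    a ^ u * a ^ (v ∸ u) ∸ a ^ u * 1  ≡⟨ *-distribˡ-∸ (a ^ u) (a ^ (v ∸ u)) 1 ⟨
    a ^ u * (a ^ (v ∸ u) ∸ 1)        ∎
    where open ≡-Reasoning

ord-exists : ∀ M .{{_ : NonZero M}} a → Coprime M (suc a) → ∃ (IsOrd M (suc a))
ord-exists M a M⊥a =
  let e , e≥1 , M∣ₑ = coprime⇒∃∣m^e∸1 M (suc a) M⊥a
      o , (o≥1 , M∣ₒ) , minimal = least-witness (λ y → 1 ≤? y ×-dec M ∣? (suc a ^ y ∸ 1)) (e≥1 , M∣ₑ)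
  in o , o≥1 , ∣⇒PowCong1 a o M∣ₒ , λ n n≥1 M∣ₙ → minimal n (n≥1 , PowCong1⇒∣ a n M∣ₙ)

IsOrd⇒∣ : IsOrd M (suc a) o → M ∣ suc a ^ e ∸ 1 → o ∣ e
IsOrd⇒∣ {M} {a} {o} {e} (o≥1 , M∣ₒ , minimal) M∣ₑ = m%n≡0⇒n∣m e o ρ≡0
  where
  instance
    o≢0 : NonZero o
    o≢0 = >-nonZero o≥1
  s ρ q : ℕ
  s = suc a
  ρ = e % o
  q = e / o
  sᵉ∸1≡ : s ^ e ∸ 1 ≡ s ^ ρ * (s ^ (q * o) ∸ 1) + (s ^ ρ ∸ 1)
  sᵉ∸1≡ = begin
    s ^ e ∸ 1                 ≡⟨ cong (λ y → s ^ y ∸ 1) (m≡m%n+[m/n]*n e o) ⟩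
    s ^ (ρ + q * o) ∸ 1       ≡⟨ cong (_∸ 1) (^-distribˡ-+-* s ρ (q * o)) ⟩
    s ^ ρ * s ^ (q * o) ∸ 1   ≡⟨ *-∸1 (m^n>0 s ρ) (m^n>0 s (q * o)) ⟩
    s ^ ρ * (s ^ (q * o) ∸ 1) + (s ^ ρ ∸ 1) ∎
    where open ≡-Reasoning
  M∣ᵨ : M ∣ s ^ ρ ∸ 1
  M∣ᵨ = ∣m+n∣m⇒∣n (subst (M ∣_) sᵉ∸1≡ M∣ₑ)
          (∣n⇒∣m*n (s ^ ρ) (∣m^n∸1⇒∣m^[o*n]∸1 s o q (PowCong1⇒∣ a o M∣ₒ)))
  ρ≡0 : ρ ≡ 0
  ρ≡0 = n<1⇒n≡0 (≰⇒> λ ρ≥1 → <⇒≱ (m%n<n e o) (minimal ρ ρ≥1 (∣⇒PowCong1 a ρ M∣ᵨ)))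

IsOrd-∣ : M ∣ N → IsOrd M (suc a) o → IsOrd N (suc a) e → o ∣ e
IsOrd-∣ {a = a} {e = e} M∣N ordₘ (_ , N∣ , _) = IsOrd⇒∣ ordₘ (∣-trans M∣N (PowCong1⇒∣ a e N∣))

r*g∣pow∸1⇒distinguished : ∀ {s′ t g r o} → g * gcd (suc s′) ∣ t ∣ ≡ suc s′ →
                           2 ≤ r → gcd r (suc (suc s′)) ≡ 1 → IsOrd r (suc (suc s′)) o →
                           r * g ∣ suc (suc s′) ^ o ∸ 1 → Distinguished (suc (suc s′)) t r
r*g∣pow∸1⇒distinguished {g = zero} ()
r*g∣pow∸1⇒distinguished {s′} {t} {g@(suc _)} {r} {o} g*c≡s∸1 r≥2 r⊥s ord r*g∣X =
  r≥2 , r⊥s , o , ord , subst (r ∣_) (sym (ℤ.abs-* t (+ Q))) (subst (r ∣_) (*-comm Q ∣ t ∣) r∣Q*t)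
  where
  X Q c : ℕ
  X = suc (suc s′) ^ o ∸ 1
  Q = repQuot (suc (suc s′)) o
  c = gcd (suc s′) ∣ t ∣
  X≡Q*c*g : X ≡ Q * c * g
  X≡Q*c*g = begin
    X               ≡⟨ m/n*n≡m (m∸1∣m^n∸1 (suc (suc s′)) o) ⟨
    Q * suc s′      ≡⟨ cong (Q *_) g*c≡s∸1 ⟨
    Q * (g * c)     ≡⟨ cong (Q *_) (*-comm g c) ⟩
    Q * (c * g)     ≡⟨ *-assoc Q c g ⟨
    Q * c * g       ∎
    where open ≡-Reasoning
  r∣Q*t : r ∣ Q * ∣ t ∣
  r∣Q*t = ∣-trans (*-cancelʳ-∣ g (subst (r * g ∣_) X≡Q*c*g r*g∣X))
                  (*-monoʳ-∣ Q (gcd[m,n]∣n (suc s′) ∣ t ∣))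

∏-prime-powers-*-∣pow∸1 : ∀ n {p e : Fin n → ℕ} → (∀ i → Prime (p i)) → Injective _≡_ _≡_ p →
                          (∀ i → ¬ p i ∣ suc a) → (∀ i → ¬ p i ∣ k) →
                          (∀ i o′ → IsOrd (p i ^ e i) (suc a) o′ → o′ ∣ o) → k ∣ suc a ^ o ∸ 1 →
                          ∏ n (λ i → p i ^ e i) * k ∣ suc a ^ o ∸ 1
∏-prime-powers-*-∣pow∸1 {a} {o = o} n {p} {e} p-prime p-inj p∤a p∤k ord∣o k∣X =
  ∏-prime-powers-*-∣ n {e = e} p-prime p-inj p∤k pᵉ∣X k∣X
  where
  pᵉ∣X : ∀ i → p i ^ e i ∣ suc a ^ o ∸ 1
  pᵉ∣X i =
    let instance _ = m^n≢0 (p i) (e i) {{prime⇒nonZero (p-prime i)}}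
        o′ , ordₒ′ = ord-exists (p i ^ e i) a (coprime-^ˡ (prime∤⇒coprime (p-prime i) (p∤a i)) (e i))
    in IsOrd⇒∣pow∸1 ordₒ′ (ord∣o i o′ ordₒ′)

proposition3p4 :
    (s : ℕ) (t : ℤ) → 2 ≤ s →
    (g : ℕ) → g * gcd (s ∸ 1) ∣ t ∣ ≡ s ∸ 1 →
    (n : ℕ) (p j : Fin n → ℕ) →
    (∀ i → Prime (p i)) → Injective _≡_ _≡_ p → (∀ i → 1 ≤ j i) →
    g ≡ ∏ n (λ i → p i ^ j i) →
    (r : ℕ) → 2 ≤ r → gcd r s ≡ 1 →
    (m : Fin n → ℕ) (k : ℕ) → 1 ≤ k → gcd k g ≡ 1 →
    r ≡ ∏ n (λ i → p i ^ m i) * k →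
    ((∀ i a b → IsOrd (p i ^ (m i + j i)) s a → IsOrd r s b → a ∣ b) →
       Distinguished s t r)
    × ((∀ i a b → IsOrd (p i ^ (m i + j i)) s a → IsOrd k s b → a ∣ b) →
       Distinguished s t r × (2 ≤ k → Distinguished s t k))
proposition3p4 (suc (suc s′)) t (s≤s (s≤s z≤n)) g g*c≡s∸1 n p j p-prime p-inj j≥1 g≡∏pʲ
               r r≥2 r⊥s m k k≥1 k⊥g r≡∏pᵐ*k =
  r-distinguished , λ hyp → r-distinguished (OrdHyp-∣ k∣r (proj₂ ordₖ) hyp) , k-distinguished hyp
  where
  s : ℕ
  s = suc (suc s′)
  OrdHyp : ℕ → Set
  OrdHyp N = ∀ i a b → IsOrd (p i ^ (m i + j i)) s a → IsOrd N s b → a ∣ b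
  instance
    r≢0 : NonZero r
    r≢0 = >-nonZero (<-trans z<s r≥2)
    k≢0 : NonZero k
    k≢0 = >-nonZero k≥1
  p∣g : ∀ i → p i ∣ g
  p∣g i = ∣-trans (1≤n⇒m∣m^n (p i) (j≥1 i)) (subst (_ ∣_) (sym g≡∏pʲ) (∣∏ n (λ i → p i ^ j i) i))
  p∤s : ∀ i → ¬ p i ∣ s
  p∤s i = prime∣n⇒∤1+n (p-prime i) (∣-trans (p∣g i) (subst (g ∣_) g*c≡s∸1 (m∣m*n _)))
  p∤k : ∀ i → ¬ p i ∣ k
  p∤k i p∣k = prime∤1 (p-prime i) (subst (p i ∣_) k⊥g (gcd-greatest p∣k (p∣g i)))
  k∣r : k ∣ r
  k∣r = subst (k ∣_) (sym r≡∏pᵐ*k) (n∣m*n (∏ n (λ i → p i ^ m i)))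
  k⊥s : Coprime k s
  k⊥s (c∣k , c∣s) = gcd≡1⇒coprime r⊥s (∣-trans c∣k k∣r , c∣s)
  ordᵣ : ∃ (IsOrd r s)
  ordᵣ = ord-exists r (suc s′) (gcd≡1⇒coprime r⊥s)
  ordₖ : ∃ (IsOrd k s)
  ordₖ = ord-exists k (suc s′) k⊥s
  OrdHyp-∣ : ∀ {N N′ o} → N ∣ N′ → IsOrd N s o → OrdHyp N → OrdHyp N′
  OrdHyp-∣ N∣N′ ordₒ hyp i a b ordₐ ordᵇ = ∣-trans (hyp i a _ ordₐ ordₒ) (IsOrd-∣ N∣N′ ordₒ ordᵇ)
  r*g∣ : ∀ {N o} → IsOrd N s o → OrdHyp N → k ∣ s ^ o ∸ 1 → r * g ∣ s ^ o ∸ 1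
  r*g∣ {o = o} ordₒ hyp k∣X = subst (_∣ s ^ o ∸ 1)
    (trans (∏-^-distribˡ-+-*ʳ n p m j k) (cong₂ _*_ (sym r≡∏pᵐ*k) (sym g≡∏pʲ)))
    (∏-prime-powers-*-∣pow∸1 n {e = λ i → m i + j i} p-prime p-inj p∤s p∤k
      (λ i a ordₐ → hyp i a _ ordₐ ordₒ) k∣X)
  r-distinguished : OrdHyp r → Distinguished s t r
  r-distinguished hyp = r*g∣pow∸1⇒distinguished {t = t} g*c≡s∸1 r≥2 r⊥s (proj₂ ordᵣ)
    (r*g∣ (proj₂ ordᵣ) hyp (∣-trans k∣r (IsOrd⇒∣pow∸1 (proj₂ ordᵣ) ∣-refl)))
  k-distinguished : OrdHyp k → 2 ≤ k → Distinguished s t k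
  k-distinguished hyp k≥2 =
    r*g∣pow∸1⇒distinguished {t = t} g*c≡s∸1 k≥2 (coprime⇒gcd≡1 k⊥s) (proj₂ ordₖ)
      (∣-trans (*-monoˡ-∣ g k∣r) (r*g∣ (proj₂ ordₖ) hyp (IsOrd⇒∣pow∸1 (proj₂ ordₖ) ∣-refl)))
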